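{- Let $G$ be a $(p,q)$-graph with $q\ge 1$. If $G$ is $k$-super graceful for some $k\ge 1$ via a $k$-super graceful labeling in which every vertex receives an odd label, then $G$ is a $(q+1,q)$-graph (i.e. $p=q+1$) and $k=1$.
   Context: All graphs are simple, finite, undirected and without isolated vertices; a $(p,q)$-graph has $p$ vertices and $q$ edges. For integers $a\le b$, $[a,b]$ denotes the set of integers $x$ with $a\le x\le b$. For $k\ge 1$, a $k$-super graceful labeling of a $(p,q)$-graph $G=(V,E)$ is a bijection $f:V\cup E\to[k,k+p+q-1]$ such that $f(uv)=|f(u)-f(v)|$ for every edge $uv\in E$; $G$ is $k$-super graceful if it admits one. -}

module Defs where

open import Data.Nat using (ℕ; _+_; _*_; _∸_; _≤_; _≥_)
open import Data.Nat.Properties using ()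
open import Data.Fin using (Fin)
open import Data.Product using (_×_; _,_; proj₁; proj₂; Σ; ∃; ∃-syntax)
open import Data.Sum using (_⊎_; inj₁; inj₂; [_,_])
open import Relation.Binary.PropositionalEquality using (_≡_; _≢_)
open import Relation.Nullary using (¬_)
open import Function.Definitions using (Injective)

∣_-_∣ : ℕ → ℕ → ℕ
∣ m - n ∣ = (m ∸ n) + (n ∸ m)

record Graph (p q : ℕ) : Set where
  field
    ends      : Fin q → Fin p × Fin p
    loopless  : ∀ e → proj₁ (ends e) ≢ proj₂ (ends e)
    simple    : ∀ e e′ →
                  (proj₁ (ends e) ≡ proj₁ (ends e′) × proj₂ (ends e) ≡ proj₂ (ends e′))
                ⊎ (proj₁ (ends e) ≡ proj₂ (ends e′) × proj₂ (ends e) ≡ proj₁ (ends e′))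
                → e ≡ e′
    noIsolated : ∀ v → ∃[ e ] (proj₁ (ends e) ≡ v ⊎ proj₂ (ends e) ≡ v)

open Graph public

record Labeling {p q : ℕ} (G : Graph p q) : Set where
  field
    fV : Fin p → ℕ
    fE : Fin q → ℕ

  label : Fin p ⊎ Fin q → ℕ
  label = [ fV , fE ]

open Labeling public

IsKSuperGraceful : {p q : ℕ} (G : Graph p q) (k : ℕ) (f : Labeling G) → Set
IsKSuperGraceful {p} {q} G k f =
    Injective _≡_ _≡_ (label f)
  × (∀ x → k ≤ label f x × label f x ≤ k + p + q ∸ 1)
  × (∀ n → k ≤ n → n ≤ k + p + q ∸ 1 → ∃[ x ] label f x ≡ n)
  × (∀ e → fE f e ≡ ∣ fV f (proj₁ (ends G e)) - fV f (proj₂ (ends G e)) ∣)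

Odd : ℕ → Set
Odd n = ∃[ m ] n ≡ 1 + 2 * m

module Submission where

-- Let f be a k-super graceful labeling of a (p,q)-graph with all
-- vertex labels odd, and let N = k + p + q ∸ 1 be the largest label.
--   * Every edge label is the distance of two odd numbers, hence even, and is
--     at most N ∸ k < N.  So N is a vertex label and therefore odd: N = 1 + 2m.
--   * The label 2m ≥ k is even, so it is an edge label: 2m ≤ (1 + 2m) ∸ k,
--     which forces k ≤ 1, i.e. k = 1 and N = p + q.
--   * The injective vertex labels are odd numbers in [1, 2m + 1], so p ≤ m + 1;
--     the injective edge labels are even numbers in [2, 2m], so q ≤ m.

open import Defs
open import Data.Nat using (ℕ; _≥_; suc; zero; _+_; _*_; _∸_; _≤_; _<_; z≤n; s≤s; s≤s⁻¹)
open import Data.Nat.Properties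
open import Data.Fin using (Fin; fromℕ<; toℕ)
open import Data.Fin.Properties using (injective⇒≤; toℕ-fromℕ<; toℕ<n)
open import Data.Product using (_×_; _,_; proj₁; proj₂; ∃-syntax)
open import Data.Sum using (inj₁; inj₂)
open import Data.Sum.Properties using (inj₁-injective; inj₂-injective)
open import Data.Empty using (⊥; ⊥-elim)
open import Function using (_∘_)
open import Function.Definitions using (Injective)
open import Relation.Binary.PropositionalEquality

Even : ℕ → Set
Even n = ∃[ j ] n ≡ 2 * j

odd⇒¬even : ∀ {n} → Odd n → Even n → ⊥
odd⇒¬even (i , refl) (j , eq) = even≢odd j i (sym eq)

∣odd-odd∣-even : ∀ {a b} → Odd a → Odd b → Even ∣ a - b ∣
∣odd-odd∣-even (i , refl) (j , refl) = (i ∸ j) + (j ∸ i) , (begin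
  (2 * i ∸ 2 * j) + (2 * j ∸ 2 * i)  ≡⟨ sym (cong₂ _+_ (*-distribˡ-∸ 2 i j) (*-distribˡ-∸ 2 j i)) ⟩
  2 * (i ∸ j) + 2 * (j ∸ i)          ≡⟨ sym (*-distribˡ-+ 2 (i ∸ j) (j ∸ i)) ⟩
  2 * ((i ∸ j) + (j ∸ i))            ∎)
  where open ≡-Reasoning

∣-∣-bounded : ∀ {k N a b} → k ≤ a → a ≤ N → k ≤ b → b ≤ N → ∣ a - b ∣ ≤ N ∸ k
∣-∣-bounded {a = a} {b} k≤a a≤N k≤b b≤N with ≤-total a b
... | inj₁ a≤b rewrite m≤n⇒m∸n≡0 a≤b = ∸-mono b≤N k≤a
... | inj₂ b≤a rewrite m≤n⇒m∸n≡0 b≤a | +-identityʳ (a ∸ b) = ∸-mono a≤N k≤b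

≤1+n∸k⇒k≤1 : ∀ {k n} → k ≤ n → n ≤ suc n ∸ k → k ≤ 1
≤1+n∸k⇒k≤1 {k} {n} k≤n n≤ = +-cancelˡ-≤ n k 1 (begin
  n + k    ≤⟨ m≤o∸n⇒m+n≤o n (m≤n⇒m≤1+n k≤n) n≤ ⟩
  suc n    ≡⟨ +-comm 1 n ⟩
  n + 1    ∎)
  where open ≤-Reasoning

+-tight : ∀ {a b x y} → a ≤ x → b ≤ y → a + b ≡ x + y → a ≡ x × b ≡ y
+-tight {a} {b} {x} {y} a≤x b≤y a+b≡x+y =
  a≡x , +-cancelˡ-≡ x b y (trans (cong (_+ b) (sym a≡x)) a+b≡x+y)
  where
  a≡x : a ≡ x
  a≡x = ≤-antisym a≤x (+-cancelʳ-≤ y x a (begin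
    x + y  ≡⟨ sym a+b≡x+y ⟩
    a + b  ≤⟨ +-monoʳ-≤ a b≤y ⟩
    a + y  ∎))
    where open ≤-Reasoning

k<top : ∀ {k p q} → p ≥ 1 → q ≥ 1 → k < k + p + q ∸ 1
k<top {k} {suc p} {suc q} _ _ = begin-strict
  k                   <⟨ n<1+n k ⟩
  suc k               ≤⟨ m≤m+n (suc k) p ⟩
  suc k + p           ≡⟨ sym (+-suc k p) ⟩
  k + suc p           ≤⟨ m≤m+n (k + suc p) q ⟩
  k + suc p + q       ≡⟨ cong (_∸ 1) (sym (+-suc (k + suc p) q)) ⟩
  k + suc p + suc q ∸ 1 ∎
  where open ≤-Reasoning

injective-into-image⇒≤ : ∀ {n m} (φ : ℕ → ℕ) (g : Fin n → ℕ) → Injective _≡_ _≡_ g →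
  (∀ e → ∃[ j ] j < m × g e ≡ φ j) → n ≤ m
injective-into-image⇒≤ {n} {m} φ g g-inj index = injective⇒≤ {f = position} position-inj
  where
  j : Fin n → ℕ
  j e = proj₁ (index e)

  position : Fin n → Fin m
  position e = fromℕ< (proj₁ (proj₂ (index e)))

  position-inj : Injective _≡_ _≡_ position
  position-inj {e} {e′} eq = g-inj (begin
    g e      ≡⟨ proj₂ (proj₂ (index e)) ⟩
    φ (j e)  ≡⟨ cong φ same-index ⟩
    φ (j e′) ≡⟨ sym (proj₂ (proj₂ (index e′))) ⟩
    g e′     ∎)
    where
    open ≡-Reasoning
    same-index : j e ≡ j e′
    same-index = trans (sym (toℕ-fromℕ< _)) (trans (cong toℕ eq) (toℕ-fromℕ< _))

odd-count : ∀ {n} m (g : Fin n → ℕ) → Injective _≡_ _≡_ g →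
  (∀ e → Odd (g e)) → (∀ e → g e ≤ 1 + 2 * m) → n ≤ suc m
odd-count m g g-inj odd bound = injective-into-image⇒≤ (λ j → 1 + 2 * j) g g-inj index
  where
  index : ∀ e → ∃[ j ] j < suc m × g e ≡ 1 + 2 * j
  index e with odd e
  ... | j , eq = j , s≤s (*-cancelˡ-≤ 2 (s≤s⁻¹ (subst (_≤ 1 + 2 * m) eq (bound e)))) , eq

even-count : ∀ {n} m (g : Fin n → ℕ) → Injective _≡_ _≡_ g →
  (∀ e → Even (g e)) → (∀ e → 1 ≤ g e × g e ≤ 2 * m) → n ≤ m
even-count m g g-inj even bounds = injective-into-image⇒≤ (λ j → 2 * suc j) g g-inj index
  where
  index : ∀ e → ∃[ j ] j < m × g e ≡ 2 * suc j
  index e with even e | bounds e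
  ... | zero  , eq | 1≤g , _ = ⊥-elim (1+n≰n (subst (1 ≤_) eq 1≤g))
  ... | suc j , eq | _ , g≤ = j , *-cancelˡ-≤ 2 (subst (_≤ 2 * m) eq g≤) , eq

module OddVertexLabeling {p q} (G : Graph p q) (f : Labeling G) {k N : ℕ}
  (injective : Injective _≡_ _≡_ (label f))
  (bounded   : ∀ x → k ≤ label f x × label f x ≤ N)
  (onto      : ∀ n → k ≤ n → n ≤ N → ∃[ x ] label f x ≡ n)
  (graceful  : ∀ e → fE f e ≡ ∣ fV f (proj₁ (ends G e)) - fV f (proj₂ (ends G e)) ∣)
  (odd       : ∀ v → Odd (fV f v))
  where

  edge-label-even : ∀ e → Even (fE f e)
  edge-label-even e rewrite graceful e =
    ∣odd-odd∣-even (odd (proj₁ (ends G e))) (odd (proj₂ (ends G e)))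

  edge-label-≤ : ∀ e → fE f e ≤ N ∸ k
  edge-label-≤ e rewrite graceful e =
    ∣-∣-bounded (proj₁ (bounded (inj₁ u))) (proj₂ (bounded (inj₁ u)))
                (proj₁ (bounded (inj₁ v))) (proj₂ (bounded (inj₁ v)))
    where
    u = proj₁ (ends G e)
    v = proj₂ (ends G e)

  -- For k ≥ 1 no edge carries the top label N, so N is an odd vertex label.
  top-label-odd : 1 ≤ k → k ≤ N → Odd N
  top-label-odd 1≤k k≤N with onto N k≤N ≤-refl
  ... | inj₁ v , fv≡N = subst Odd fv≡N (odd v)
  ... | inj₂ e , fe≡N = ⊥-elim (<⇒≱ (∸-monoʳ-< 1≤k k≤N) (subst (_≤ N ∸ k) fe≡N (edge-label-≤ e)))

  -- With N = 1 + 2m, the even label 2m can only be an edge label, which forces k ≤ 1.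
  k≤1 : 1 ≤ k → k < N → k ≤ 1
  k≤1 1≤k k<N with top-label-odd 1≤k (<⇒≤ k<N)
  ... | m , refl with onto (2 * m) (s≤s⁻¹ k<N) (n≤1+n (2 * m))
  ...   | inj₁ v , fv≡2m = ⊥-elim (odd⇒¬even (odd v) (m , fv≡2m))
  ...   | inj₂ e , fe≡2m = ≤1+n∸k⇒k≤1 (s≤s⁻¹ k<N) (subst (_≤ N ∸ k) fe≡2m (edge-label-≤ e))

  vertex-count : ∀ m → N ≡ 1 + 2 * m → p ≤ suc m
  vertex-count m N≡ = odd-count m (fV f) (inj₁-injective ∘ injective) odd
    (λ v → subst (fV f v ≤_) N≡ (proj₂ (bounded (inj₁ v))))

  edge-count : ∀ m → 1 ≤ k → N ≡ 1 + 2 * m → q ≤ m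
  edge-count m 1≤k N≡ = even-count m (fE f) (inj₂-injective ∘ injective) edge-label-even
    (λ e → ≤-trans 1≤k (proj₁ (bounded (inj₂ e))) ,
           ≤-trans (edge-label-≤ e) (subst (λ n → N ∸ k ≤ n ∸ 1) N≡ (∸-monoʳ-≤ N 1≤k)))

vertex-exists : ∀ {p q} → Graph p q → q ≥ 1 → p ≥ 1
vertex-exists G q≥1 = ≤-trans (s≤s z≤n) (toℕ<n (proj₁ (ends G (fromℕ< q≥1))))

theorem2p8 : {p q : ℕ} (G : Graph p q) → q ≥ 1 →
    (k : ℕ) → k ≥ 1 → (f : Labeling G) → IsKSuperGraceful G k f →
    (∀ v → Odd (fV f v)) →
    p ≡ suc q × k ≡ 1
theorem2p8 {p} {q} G q≥1 k k≥1 f (injective , bounded , onto , graceful) odd =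
  p≡1+q , k≡1
  where
  open OddVertexLabeling G f injective bounded onto graceful odd

  k<N : k < k + p + q ∸ 1
  k<N = k<top (vertex-exists G q≥1) q≥1

  k≡1 : k ≡ 1
  k≡1 = ≤-antisym (k≤1 k≥1 k<N) k≥1

  m : ℕ
  m = proj₁ (top-label-odd k≥1 (<⇒≤ k<N))

  N≡1+2m : k + p + q ∸ 1 ≡ 1 + 2 * m
  N≡1+2m = proj₂ (top-label-odd k≥1 (<⇒≤ k<N))

  p+q≡1+2m : p + q ≡ suc m + m
  p+q≡1+2m = begin
    p + q              ≡⟨ cong (λ k → k + p + q ∸ 1) (sym k≡1) ⟩
    k + p + q ∸ 1      ≡⟨ N≡1+2m ⟩
    1 + 2 * m          ≡⟨ cong suc (cong (m +_) (+-identityʳ m)) ⟩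
    suc m + m          ∎
    where open ≡-Reasoning

  p≡1+q : p ≡ suc q
  p≡1+q with +-tight (vertex-count m N≡1+2m) (edge-count m k≥1 N≡1+2m) p+q≡1+2m
  ... | p≡1+m , q≡m = trans p≡1+m (cong suc (sym q≡m))
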